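{- Let $G$ be a connected outerplanar graph, let $\overrightarrow{G'}$ be a BFS-digraph of $G$, and fix a straight-line drawing of $\overrightarrow{G'}$ in which (1) each vertex at depth $i$ lies on the line $y=-i$, (2) any two edges are disjoint except possibly at common endpoints, and (3) for every vertex $v$ the vertical downward ray from $v$ meets the drawing only at $v$. If two consecutive vertices $w_1,w_2$ are such that one is a left child and the other is a right child of the same parent $u$, then $w_1$ and $w_2$ have no common child.
   Context: Given a connected graph $G=(V,E)$ and a root vertex $r$, let $V_i$ be the set of vertices at distance exactly $i$ from $r$. The BFS-digraph $\overrightarrow{G'}$ has vertex set $V$ and an arc $\overrightarrow{(u,v)}$ for every edge $uv\in E$ with $u\in V_i$, $v\in V_{i+1}$ for some $i$; the depth of a vertex is the $i$ with $v\in V_i$. If $\overrightarrow{(u,v)}$ is an arc, $u$ is a parent of $v$ and $v$ is a child of $u$. In the drawing, a child $w$ of $u$ is a left child of $u$ if $w$ lies to the left of $u$ (smaller $x$-coordinate) and a right child if it lies to the right. Two vertices are consecutive if they lie on the same horizontal line and no vertex lies between them.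
   Formalization: The straight-line drawing of $\overrightarrow{G'}$ is taken in the rational plane, so its vertices lie at points with rational coordinates. -}

module Defs where

open import Data.Nat using (ℕ; zero; suc; _≤_) renaming (_<_ to _<ℕ_)
open import Data.Fin using (Fin; toℕ)
open import Data.Integer using (+_)
open import Data.Rational using (ℚ; _/_; _+_; _*_; _-_; -_; 0ℚ; 1ℚ) renaming (_≤_ to _≤ℚ_; _<_ to _<ℚ_)
open import Data.Product using (Σ; ∃; _×_; _,_; proj₁; proj₂)
open import Data.Sum using (_⊎_)
open import Relation.Binary.PropositionalEquality using (_≡_; _≢_)
open import Relation.Nullary using (¬_)

record Graph (n : ℕ) : Set₁ where
  field
    Adj    : Fin n → Fin n → Set
    sym    : ∀ {u v} → Adj u v → Adj v u
    irrefl : ∀ {u} → ¬ Adj u u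
open Graph public

data Walk {n : ℕ} (G : Graph n) : Fin n → Fin n → ℕ → Set where
  nil  : ∀ {u} → Walk G u u zero
  cons : ∀ {u v w k} → Adj G u v → Walk G v w k → Walk G u w (suc k)

Connected : ∀ {n} → Graph n → Set
Connected G = ∀ u v → ∃ λ k → Walk G u v k

Dist : ∀ {n} → Graph n → Fin n → Fin n → ℕ → Set
Dist G u v i = Walk G u v i × (∀ j → Walk G u v j → i ≤ j)

-- Outerplanar: the vertices can be placed on a circle (cyclic position
-- given by a bijection pos : Fin n → Fin n) so that edges, drawn as
-- chords, pairwise do not cross, i.e. no two edges ab, cd have
-- interleaving endpoints pos a < pos c < pos b < pos d.
Outerplanar : ∀ {n} → Graph n → Set
Outerplanar {n} G =
  Σ (Fin n → Fin n) λ pos →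
    (∀ u v → toℕ (pos u) ≡ toℕ (pos v) → u ≡ v) ×
    (∀ a b c d → Adj G a b → Adj G c d →
       ¬ (toℕ (pos a) <ℕ toℕ (pos c) × toℕ (pos c) <ℕ toℕ (pos b) ×
          toℕ (pos b) <ℕ toℕ (pos d)))

-- BFS-digraph rooted at r: arc u → v iff uv ∈ E, u at depth i, v at depth i+1

Depth : ∀ {n} → Graph n → Fin n → Fin n → ℕ → Set
Depth G r v i = Dist G r v i

Arc : ∀ {n} → Graph n → Fin n → Fin n → Fin n → Set
Arc G r u v = Adj G u v × ∃ λ i → Depth G r u i × Depth G r v (suc i)

Point : Set
Point = ℚ × ℚ

OnSeg : Point → Point → Point → Set
OnSeg (px , py) (ax , ay) (bx , by) =
  Σ ℚ λ t → (0ℚ ≤ℚ t) × (t ≤ℚ 1ℚ) ×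
    (px ≡ ax + t * (bx - ax)) × (py ≡ ay + t * (by - ay))

ℕtoℚ : ℕ → ℚ
ℕtoℚ k = (+ k) / 1

module _ {n : ℕ} (G : Graph n) (r : Fin n) (pos : Fin n → Point) where

  xc : Fin n → ℚ
  xc v = proj₁ (pos v)

  yc : Fin n → ℚ
  yc v = proj₂ (pos v)

  OnDrawing : Point → Set
  OnDrawing p = (∃ λ v → pos v ≡ p) ⊎
                (∃ λ u → ∃ λ v → Arc G r u v × OnSeg p (pos u) (pos v))

  record GoodDrawing : Set where
    field
      injective   : ∀ u v → pos u ≡ pos v → u ≡ v
      noVertexOnEdge : ∀ u v w → Arc G r u v → w ≢ u → w ≢ v →
                         ¬ OnSeg (pos w) (pos u) (pos v)
      levels      : ∀ v i → Depth G r v i → yc v ≡ - ℕtoℚ i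
      planar      : ∀ u v u' v' → Arc G r u v → Arc G r u' v' →
                      ¬ (u ≡ u' × v ≡ v') →
                      ∀ p → OnSeg p (pos u) (pos v) → OnSeg p (pos u') (pos v') →
                      ∃ λ w → (w ≡ u ⊎ w ≡ v) × (w ≡ u' ⊎ w ≡ v') × p ≡ pos w
      downRay     : ∀ v y → y ≤ℚ yc v → OnDrawing (xc v , y) → y ≡ yc v

  LeftChild : Fin n → Fin n → Set
  LeftChild w u = Arc G r u w × xc w <ℚ xc u

  RightChild : Fin n → Fin n → Set
  RightChild w u = Arc G r u w × xc u <ℚ xc w

  Consecutive : Fin n → Fin n → Set
  Consecutive w₁ w₂ =
    w₁ ≢ w₂ × yc w₁ ≡ yc w₂ ×
    (∀ z → yc z ≡ yc w₁ →
       ¬ ((xc w₁ <ℚ xc z × xc z <ℚ xc w₂) ⊎ (xc w₂ <ℚ xc z × xc z <ℚ xc w₁)))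

{-# OPTIONS --safe #-}
-- The vertical ray below u separates the two children: it lies strictly between
-- the left child w₁ and the right child w₂. A common child c is on one side of
-- it, so the edge from c to the child on the other side crosses the line
-- x = xc u, and does so below u because both of its endpoints lie deeper than
-- u. Condition (3) forbids that.
module Submission where

open import Defs
open import Data.Nat using (ℕ; suc) renaming (_<_ to _<ℕ_)
import Data.Nat.Properties as ℕ
open import Data.Fin using (Fin)
import Data.Integer as ℤ
import Data.Integer.Properties as ℤ
open import Data.Integer using (+_)
open import Data.Nat.Coprimality using (1-coprimeTo)
import Data.Nat.Coprimality as Coprimality
open import Data.Rational
  using (0ℚ; 1ℚ; _+_; _*_; _-_; -_; 1/_; _÷_; _≤_; _<_; *<*;
         NonZero; Positive; NonNegative; positive; nonNegative)
open import Data.Rational.Properties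
open import Data.Rational.Solver using (module +-*-Solver)
open import Data.Product using (∃; _×_; _,_; proj₁; proj₂)
open import Data.Sum using (_⊎_; inj₁; inj₂)
open import Data.Empty using (⊥)
open import Relation.Nullary using (¬_)
open import Relation.Binary.PropositionalEquality
  using (_≡_; refl; cong; subst; subst₂; module ≡-Reasoning)
import Relation.Binary.PropositionalEquality as Eq

open +-*-Solver using (solve; _:=_; _:+_; _:-_; _:*_; con)

ℕtoℚ-mono-< : ∀ {m n} → m <ℕ n → ℕtoℚ m < ℕtoℚ n
ℕtoℚ-mono-< {m} {n} m<n
  rewrite normalize-coprime (Coprimality.sym (1-coprimeTo m))
        | normalize-coprime (Coprimality.sym (1-coprimeTo n)) =
  *<* (subst₂ ℤ._<_ (Eq.sym (ℤ.*-identityʳ (+ m))) (Eq.sym (ℤ.*-identityʳ (+ n)))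
                    (ℤ.+<+ m<n))

p≤q⇒0≤q-p : ∀ {p q} → p ≤ q → 0ℚ ≤ q - p
p≤q⇒0≤q-p {p} {q} p≤q = subst (_≤ q - p) (+-inverseʳ p) (+-monoˡ-≤ (- p) p≤q)

p<q⇒0<q-p : ∀ {p q} → p < q → 0ℚ < q - p
p<q⇒0<q-p {p} {q} p<q = subst (_< q - p) (+-inverseʳ p) (+-monoˡ-< (- p) p<q)

÷-between-0-1 : ∀ {s d} .{{_ : NonZero d}} .{{_ : Positive d}} →
                0ℚ ≤ s → s ≤ d → 0ℚ ≤ s ÷ d × s ÷ d ≤ 1ℚ
÷-between-0-1 {s} {d} 0≤s s≤d =
  nonNegative⁻¹ (s ÷ d) {{nonNeg*nonNeg⇒nonNeg s {{nonNegative 0≤s}} (1/ d) {{1/d≥0}}}} ,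
  subst (s ÷ d ≤_) (*-inverseʳ d) (*-monoʳ-≤-nonNeg (1/ d) {{1/d≥0}} s≤d)
  where
  1/d≥0 : NonNegative (1/ d)
  1/d≥0 = pos⇒nonNeg ((1/ d) {{pos⇒nonZero d}}) {{1/pos⇒pos d}}

interpolate-≤ : ∀ {t y₁ y₂ h} → 0ℚ ≤ t → t ≤ 1ℚ → y₁ ≤ h → y₂ ≤ h →
                y₁ + t * (y₂ - y₁) ≤ h
interpolate-≤ {t} {y₁} {y₂} {h} 0≤t t≤1 y₁≤h y₂≤h = begin
  y₁ + t * (y₂ - y₁)         ≡⟨ solve 3 (λ t y₁ y₂ → y₁ :+ t :* (y₂ :- y₁) := (con 1ℚ :- t) :* y₁ :+ t :* y₂) refl t y₁ y₂ ⟩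
  (1ℚ - t) * y₁ + t * y₂     ≤⟨ +-mono-≤ (*-monoˡ-≤-nonNeg (1ℚ - t) {{nonNegative (p≤q⇒0≤q-p t≤1)}} y₁≤h)
                                         (*-monoˡ-≤-nonNeg t {{nonNegative 0≤t}} y₂≤h) ⟩
  (1ℚ - t) * h + t * h       ≡⟨ solve 2 (λ t h → (con 1ℚ :- t) :* h :+ t :* h := h) refl t h ⟩
  h                          ∎
  where open ≤-Reasoning

OnSeg-sym : ∀ p a b → OnSeg p a b → OnSeg p b a
OnSeg-sym _ (ax , ay) (bx , by) (t , 0≤t , t≤1 , refl , refl) =
  1ℚ - t , p≤q⇒0≤q-p t≤1 , 1-t≤1 , reverse ax bx , reverse ay by
  where
  1-t≤1 : 1ℚ - t ≤ 1ℚ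
  1-t≤1 = subst₂ _≤_ (+-comm (- t) 1ℚ) (+-identityˡ 1ℚ)
            (+-monoˡ-≤ 1ℚ (neg-antimono-≤ 0≤t))
  reverse : ∀ a b → a + t * (b - a) ≡ b + (1ℚ - t) * (a - b)
  reverse = solve 3 (λ t a b → a :+ t :* (b :- a) := b :+ (con 1ℚ :- t) :* (a :- b)) refl t

vertical-meets-segment : ∀ {x₁ y₁ x₂ y₂ a h} → x₁ < x₂ → x₁ ≤ a → a ≤ x₂ →
  y₁ ≤ h → y₂ ≤ h → ∃ λ y → y ≤ h × OnSeg (a , y) (x₁ , y₁) (x₂ , y₂)
vertical-meets-segment {x₁} {y₁} {x₂} {y₂} {a} x₁<x₂ x₁≤a a≤x₂ y₁≤h y₂≤h =
  y₁ + t * (y₂ - y₁) , interpolate-≤ 0≤t t≤1 y₁≤h y₂≤h , t , 0≤t , t≤1 , a≡ , refl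
  where
  d = x₂ - x₁
  instance
    d>0 : Positive d
    d>0 = positive (p<q⇒0<q-p x₁<x₂)
    d≢0 : NonZero d
    d≢0 = pos⇒nonZero d
  t = (a - x₁) ÷ d
  t∈[0,1] = ÷-between-0-1 (p≤q⇒0≤q-p x₁≤a) (+-monoˡ-≤ (- x₁) a≤x₂)
  0≤t = proj₁ t∈[0,1]
  t≤1 = proj₂ t∈[0,1]
  a≡ : a ≡ x₁ + t * d
  a≡ = begin
    a                              ≡⟨ solve 2 (λ a x₁ → a := x₁ :+ (a :- x₁)) refl a x₁ ⟩
    x₁ + (a - x₁)                  ≡⟨ cong (λ z → x₁ + z) (Eq.sym (*-identityʳ (a - x₁))) ⟩
    x₁ + (a - x₁) * 1ℚ             ≡⟨ cong (λ z → x₁ + (a - x₁) * z) (Eq.sym (*-inverseˡ d)) ⟩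
    x₁ + (a - x₁) * (1/ d * d)     ≡⟨ cong (λ z → x₁ + z) (Eq.sym (*-assoc (a - x₁) (1/ d) d)) ⟩
    x₁ + t * d                     ∎
    where open ≡-Reasoning

module _ {n : ℕ} {G : Graph n} {r : Fin n} {pos : Fin n → Point}
         (drawing : GoodDrawing G r pos) where
  open GoodDrawing drawing

  private
    X = xc G r pos
    Y = yc G r pos

  arc-descends : ∀ {u v} → Arc G r u v → Y v < Y u
  arc-descends {u} {v} (_ , i , depth-u , depth-v) =
    subst₂ _<_ (Eq.sym (levels v (suc i) depth-v)) (Eq.sym (levels u i depth-u))
               (neg-antimono-< (ℕtoℚ-mono-< (ℕ.n<1+n i)))

  drawing-avoids-below : ∀ u {y} → y < Y u → ¬ OnDrawing G r pos (X u , y)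
  drawing-avoids-below u y<Yu on = <⇒≢ y<Yu (downRay u _ (<⇒≤ y<Yu) on)

  arc-avoids-below : ∀ u {v c y} → Arc G r v c → Y v < Y u → y ≤ Y v →
                     ¬ OnSeg (X u , y) (pos v) (pos c)
  arc-avoids-below u {v} {c} vc Yv<Yu y≤Yv seg =
    drawing-avoids-below u (≤-<-trans y≤Yv Yv<Yu) (inj₂ (v , c , vc , seg))

  left-right-children-no-common-child : ∀ {u wₗ wᵣ c} →
    LeftChild G r pos wₗ u → RightChild G r pos wᵣ u →
    Arc G r wₗ c → Arc G r wᵣ c → ⊥
  left-right-children-no-common-child {u} {wₗ} {wᵣ} {c} (uwₗ , Xwₗ<Xu) (uwᵣ , Xu<Xwᵣ) wₗc wᵣc
    with ≤-total (X c) (X u)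
  ... | inj₁ Xc≤Xu =
    let y , y≤ , seg = vertical-meets-segment (≤-<-trans Xc≤Xu Xu<Xwᵣ) Xc≤Xu (<⇒≤ Xu<Xwᵣ)
                         (<⇒≤ (arc-descends wᵣc)) ≤-refl
    in arc-avoids-below u wᵣc (arc-descends uwᵣ) y≤ (OnSeg-sym _ (pos c) (pos wᵣ) seg)
  ... | inj₂ Xu≤Xc =
    let y , y≤ , seg = vertical-meets-segment (<-≤-trans Xwₗ<Xu Xu≤Xc) (<⇒≤ Xwₗ<Xu) Xu≤Xc
                         ≤-refl (<⇒≤ (arc-descends wₗc))
    in arc-avoids-below u wₗc (arc-descends uwₗ) y≤ seg

corollary2 : ∀ {n} (G : Graph n) (r : Fin n) (pos : Fin n → Point) →
    Connected G → Outerplanar G → GoodDrawing G r pos →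
    ∀ u w₁ w₂ → Consecutive G r pos w₁ w₂ →
    ((LeftChild G r pos w₁ u × RightChild G r pos w₂ u) ⊎
     (RightChild G r pos w₁ u × LeftChild G r pos w₂ u)) →
    ¬ (∃ λ c → Arc G r w₁ c × Arc G r w₂ c)
corollary2 G r pos _ _ drawing u w₁ w₂ _ (inj₁ (left₁ , right₂)) (c , w₁c , w₂c) =
  left-right-children-no-common-child drawing left₁ right₂ w₁c w₂c
corollary2 G r pos _ _ drawing u w₁ w₂ _ (inj₂ (right₁ , left₂)) (c , w₁c , w₂c) =
  left-right-children-no-common-child drawing left₂ right₁ w₂c w₁c
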